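{- Any streaming certification scheme for $\mathrm{MaxIS}_{\leq}$ whose verifier uses $m$ bits of memory and whose certificates have $c$ bits satisfies $c+m=\Omega(n^2)$ on $n$-node graphs.
   Context: $\mathrm{MaxIS}_{\leq}$ takes as input a graph $G$ and a threshold $k$ and asks whether the maximum independent set of $G$ has size at most $k$. Inputs: an $n$-node graph on $[n]$ and threshold $k$; $k$ is given first, then the edges arrive as a stream in an arbitrary, possibly adversarial, order. A streaming certification scheme for a decision problem $P$ consists of a prover (a computationally unlimited function producing a certificate in $\{0,1\}^*$ depending only on the input, not on the edge order) and a verifier (a deterministic streaming algorithm with read-only access to the certificate that processes the stream and outputs accept or reject). Completeness: if the input satisfies $P$, some certificate makes the verifier accept for every edge order. Soundness: if the input does not satisfy $P$, the verifier rejects for every certificate and every edge order. $c$ is the certificate length and $m$ the verifier's memory excluding the certificate, as worst-case functions of $n$. -}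

module Defs where

open import Data.Bool using (Bool; true; false)
open import Data.Nat using (ℕ; _≤_; _+_; _*_)
open import Data.Fin using (Fin) renaming (_<_ to _<ᶠ_)
open import Data.Fin.Subset using (Subset; ∣_∣) renaming (_∈_ to _∈ₛ_)
open import Data.Product using (Σ; Σ-syntax; ∃; ∃-syntax; _×_; _,_; proj₁; proj₂)
open import Data.List using (List; foldl; length)
open import Data.List.Membership.Propositional using (_∈_)
open import Data.List.Relation.Unary.Unique.Propositional using (Unique)
open import Data.Vec using (Vec)
open import Relation.Binary.PropositionalEquality using (_≡_)
open import Relation.Nullary using (¬_)

-- An (undirected) edge of a simple graph on [n], written canonically as (u , v) with u < v.
Edge : ℕ → Set
Edge n = Σ[ p ∈ Fin n × Fin n ] (proj₁ p <ᶠ proj₂ p)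

Graph : ℕ → Set
Graph n = Edge n → Bool

Independent : ∀ {n} → Graph n → Subset n → Set
Independent {n} G S =
  (u v : Fin n) (u<v : u <ᶠ v) → G ((u , v) , u<v) ≡ true → ¬ (u ∈ₛ S × v ∈ₛ S)

MaxIS≤ : ∀ {n} → Graph n → ℕ → Set
MaxIS≤ {n} G k = (S : Subset n) → Independent G S → ∣ S ∣ ≤ k

IsEdgeOrder : ∀ {n} → Graph n → List (Edge n) → Set
IsEdgeOrder {n} G es =
  Unique es × ((e : Edge n) → (e ∈ es → G e ≡ true) × (G e ≡ true → e ∈ es))

Certificate : Set
Certificate = List Bool

record Verifier (n m : ℕ) : Set where
  field
    init   : Certificate → ℕ → Vec Bool m
    step   : Certificate → Vec Bool m → Edge n → Vec Bool m
    accept : Certificate → Vec Bool m → Bool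

run : ∀ {n m} → Verifier n m → Certificate → ℕ → List (Edge n) → Bool
run V cert k es = Verifier.accept V cert (foldl (Verifier.step V cert) (Verifier.init V cert k) es)

-- V (with certificates of at most c bits) is a streaming certification scheme for MaxIS_≤
-- on n-node graphs. (The prover is encoded by the existence of a certificate depending only
-- on the input (k , G), which works for every edge order.)
IsCertScheme : (n c m : ℕ) → Verifier n m → Set
IsCertScheme n c m V =
  ((k : ℕ) (G : Graph n) → MaxIS≤ G k →
     Σ[ cert ∈ Certificate ] (length cert ≤ c ×
       ((es : List (Edge n)) → IsEdgeOrder G es → run V cert k es ≡ true)))
  ×
  ((k : ℕ) (G : Graph n) → ¬ MaxIS≤ G k →
     (cert : Certificate) (es : List (Edge n)) → IsEdgeOrder G es → run V cert k es ≡ false)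

HasScheme : (n c m : ℕ) → Set
HasScheme n c m = Σ[ V ∈ Verifier n m ] IsCertScheme n c m V

-- A fooling-set argument. For s × s Boolean matrices M, M′ let G(M, M′) be the graph on four blocks
-- A, B, C, D of s vertices in which every block is a clique, a_i ∼ c_j and b_i ∼ d_j iff i ≠ j,
-- a_i ∼ b_j iff M i j, and c_i ∼ d_j iff ¬ M′ i j. An independent set meets each block at most once,
-- and meeting all four needs indices with M i j = false and M′ i j = true. So G(M, M) is a yes-instance
-- of MaxIS≤ with k = 3, while G(M, M′) is a no-instance as soon as M and M′ disagree in that way.
-- Stream first the edges depending only on M, then those depending only on M′. If two matrices gave
-- the same certificate for G(M, M) and the same memory after the first half, the verifier could not
-- tell G(M, M′) from G(M′, M′) and would accept a no-instance. Hence the 2^(s²) matrices yield distinct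
-- pairs (certificate, memory), so s² ≤ c + 1 + m; with s = ⌊n / 4⌋ this gives n² ≤ 72 (c + m).
module Submission where

open import Defs
open import Data.Nat using (ℕ; _≤_; _+_; _*_)
open import Data.Product using (Σ; Σ-syntax; ∃; ∃-syntax; _×_; _,_)

open import Data.Bool using (Bool; true; false; _∨_; not)
open import Data.Bool.Properties using (∨-comm; ∨-zeroʳ; ∨-conicalˡ; ∨-conicalʳ; ¬-not; not-injective)
  renaming (_≟_ to _≟ᵇ_)
open import Data.Empty using (⊥; ⊥-elim)
open import Data.Fin using (Fin; zero; suc; toℕ; inject≤; combine; remQuot) renaming (_<_ to _<ᶠ_)
open import Data.Fin.Properties
  using (_≟_; _<?_; <-cmp; <-irrelevant; <⇒≢; suc-injective; toℕ-injective; toℕ-inject≤; toℕ-fromℕ<; toℕ<n;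
         injective⇒≤; combine-remQuot; *↔×; 2↔Bool; any?; all?; ¬∀⟶∃¬)
open import Data.Fin.Subset using (Subset; ∣_∣; ⊤; _-_) renaming (_∈_ to _∈ₛ_)
open import Data.Fin.Subset.Properties using (_∈?_; ∈⊤; x∈p⇒∣p-x∣<∣p∣; x∈p∧x≢y⇒x∈p-y)
open import Data.List
  using (List; []; _∷_; _++_; length; foldl; filter; deduplicate; concatMap; allFin; cartesianProduct)
open import Data.List.Properties using (foldl-++)
open import Data.List.Membership.Propositional using (_∈_; lose)
open import Data.List.Membership.Propositional.Properties
  using (∈-allFin; ∈-cartesianProduct⁺; ∈-concatMap⁺; ∈-deduplicate⁺; ∈-filter⁺; ∈-filter⁻; ∈-++⁺ˡ; ∈-++⁺ʳ; ∈-++⁻)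
open import Data.List.Relation.Unary.Any using (here)
open import Data.List.Relation.Unary.Unique.Propositional using (Unique)
open import Data.List.Relation.Unary.Unique.Propositional.Properties using (++⁺) renaming (filter⁺ to unique-filter⁺)
open import Data.List.Relation.Unary.Unique.DecPropositional.Properties using (deduplicate-!)
open import Data.Nat using (zero; suc; _^_; z≤n; s≤s; NonZero; >-nonZero; _/_)
open import Data.Nat.DivMod using (_mod_; _%_; m<n⇒m%n≡m; m≡m%n+[m/n]*n; m%n<n; m/n*n≤m; /-monoˡ-≤)
open import Data.Nat.Properties
  using (≤-trans; ≤-pred; <⇒≤; <-irrefl; ≮⇒≥; <⇒≱; ^-monoʳ-<; *-comm; *-mono-≤; *-monoʳ-≤; +-monoˡ-≤; m*n≢0;
         module ≤-Reasoning)
open import Data.Nat.Solver using (module +-*-Solver)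
open import Data.Product using (proj₁; proj₂; uncurry)
open import Data.Product.Properties using (≡-dec; ,-injectiveˡ)
open import Data.Sum using (inj₁; inj₂)
open import Data.Vec using (Vec; lookup; tabulate; replicate) renaming (_∷_ to _∷ᵛ_; [] to []ᵛ; _++_ to _++ᵛ_)
open import Data.Vec.Base using (here; there)
open import Data.Vec.Properties
  using (∷-injectiveˡ; ∷-injectiveʳ; ++-injective; lookup⇒[]=; []=⇒lookup; lookup∘tabulate; tabulate∘lookup;
         tabulate-cong)
open import Data.Vec.Recursive using (Fin[m^n]↔Fin[m]^n; lift↔)
open import Data.Vec.Recursive.Properties using (↔Vec)
open import Function using (_∘_; Injection; _↔_; _↣_; _↩_; mk↩; mk↣; LeftInverse)
open import Function.Construct.Composition using (_↔-∘_; _↣-∘_; _↩-∘_)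
open import Function.Properties.Inverse using (↔⇒↣; ↔⇒↩; ↔-sym)
open import Relation.Binary.Definitions using (DecidableEquality; tri<; tri≈; tri>)
open import Relation.Binary.PropositionalEquality
  using (_≡_; _≢_; refl; sym; trans; cong; cong₂; subst; module ≡-Reasoning)
open import Relation.Nullary using (¬_; Dec; yes; no; does; contradiction)
open import Relation.Nullary.Decidable using (dec-true; _×-dec_)

open +-*-Solver using (solve; _:+_; _:*_; con; _:=_)

Fin[2^k]↔Vec[Bool] : ∀ k → Fin (2 ^ k) ↔ Vec Bool k
Fin[2^k]↔Vec[Bool] k = ↔Vec k ↔-∘ (lift↔ k 2↔Bool ↔-∘ Fin[m^n]↔Fin[m]^n 2 k)

Vec[Bool]↣⇒≤ : ∀ {a b} → Vec Bool a ↣ Vec Bool b → a ≤ b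
Vec[Bool]↣⇒≤ {a} {b} f =
  ≮⇒≥ λ b<a → <⇒≱ (^-monoʳ-< 2 (s≤s (s≤s z≤n)) b<a) (injective⇒≤ (Injection.injective g))
  where
  g : Fin (2 ^ a) ↣ Fin (2 ^ b)
  g = ↔⇒↣ (↔-sym (Fin[2^k]↔Vec[Bool] b)) ↣-∘ (f ↣-∘ ↔⇒↣ (Fin[2^k]↔Vec[Bool] a))

-- The marker true after the bits makes pad injective on lists of length at most c.
pad : (c : ℕ) → List Bool → Vec Bool (suc c)
pad zero    _        = true ∷ᵛ []ᵛ
pad (suc c) []       = true ∷ᵛ replicate (suc c) false
pad (suc c) (b ∷ bs) = b ∷ᵛ pad c bs

pad≢falses : ∀ c bs → pad c bs ≢ replicate (suc c) false
pad≢falses zero    _        ()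
pad≢falses (suc c) []       ()
pad≢falses (suc c) (b ∷ bs) eq = pad≢falses c bs (∷-injectiveʳ eq)

pad-injective : ∀ {c bs bs′} → length bs ≤ c → length bs′ ≤ c → pad c bs ≡ pad c bs′ → bs ≡ bs′
pad-injective {zero}  {[]}     {[]}       _        _         _  = refl
pad-injective {suc c} {[]}     {[]}       _        _         _  = refl
pad-injective {suc c} {[]}     {_ ∷ bs′}  _        _         eq = contradiction (sym (∷-injectiveʳ eq)) (pad≢falses c bs′)
pad-injective {suc c} {_ ∷ bs} {[]}       _        _         eq = contradiction (∷-injectiveʳ eq) (pad≢falses c bs)
pad-injective {suc c} {_ ∷ _}  {_ ∷ _}    (s≤s ≤c) (s≤s ≤c′) eq =
  cong₂ _∷_ (∷-injectiveˡ eq) (pad-injective ≤c ≤c′ (∷-injectiveʳ eq))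

Fin[n]↩Fin[d] : ∀ {n d} .{{_ : NonZero d}} → d ≤ n → Fin n ↩ Fin d
Fin[n]↩Fin[d] {d = d} d≤n = mk↩ {to = λ u → toℕ u mod d} {from = λ i → inject≤ i d≤n} mod∘inject≤
  where
  mod∘inject≤ : ∀ {i u} → u ≡ inject≤ i d≤n → toℕ u mod d ≡ i
  mod∘inject≤ {i} refl = toℕ-injective (begin
    toℕ (toℕ (inject≤ i d≤n) mod d) ≡⟨ toℕ-fromℕ< _ ⟩
    toℕ (inject≤ i d≤n) % d         ≡⟨ cong (_% d) (toℕ-inject≤ i d≤n) ⟩
    toℕ i % d                       ≡⟨ m<n⇒m%n≡m (toℕ<n i) ⟩
    toℕ i                           ∎)
    where open ≡-Reasoning

module _ {n : ℕ} where

  _≟ᴱ_ : DecidableEquality (Edge n)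
  _≟ᴱ_ = ≡-dec (≡-dec _≟_ _≟_) (λ u<v u<v′ → yes (<-irrelevant u<v u<v′))

  edgeIfIncreasing : Fin n → Fin n → List (Edge n)
  edgeIfIncreasing u v with u <? v
  ... | yes u<v = ((u , v) , u<v) ∷ []
  ... | no  _   = []

  ∈-edgeIfIncreasing : ∀ {u v} (u<v : u <ᶠ v) → ((u , v) , u<v) ∈ edgeIfIncreasing u v
  ∈-edgeIfIncreasing {u} {v} u<v with u <? v
  ... | yes u<v′ = here (cong ((u , v) ,_) (<-irrelevant u<v u<v′))
  ... | no  u≮v  = contradiction u<v u≮v

  -- Deduplicating spares a proof that this list has no repetitions.
  increasingPairs : List (Edge n)
  increasingPairs = concatMap (uncurry edgeIfIncreasing) (cartesianProduct (allFin n) (allFin n))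

  allEdges : List (Edge n)
  allEdges = deduplicate _≟ᴱ_ increasingPairs

  allEdges-unique : Unique allEdges
  allEdges-unique = deduplicate-! _≟ᴱ_ increasingPairs

  ∈-allEdges : ∀ e → e ∈ allEdges
  ∈-allEdges ((u , v) , u<v) = ∈-deduplicate⁺ _≟ᴱ_ (∈-concatMap⁺ (uncurry edgeIfIncreasing)
    (lose (∈-cartesianProduct⁺ (∈-allFin u) (∈-allFin v)) (∈-edgeIfIncreasing u<v)))

  edgesWhere : Graph n → List (Edge n)
  edgesWhere G = filter (λ e → G e ≟ᵇ true) allEdges

  edgesWhere-unique : ∀ G → Unique (edgesWhere G)
  edgesWhere-unique G = unique-filter⁺ (λ e → G e ≟ᵇ true) allEdges-unique

  ∈-edgesWhere⁺ : ∀ G {e} → G e ≡ true → e ∈ edgesWhere G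
  ∈-edgesWhere⁺ G {e} Ge = ∈-filter⁺ (λ e → G e ≟ᵇ true) (∈-allEdges e) Ge

  ∈-edgesWhere⁻ : ∀ G {e} → e ∈ edgesWhere G → G e ≡ true
  ∈-edgesWhere⁻ G e∈ = proj₂ (∈-filter⁻ (λ e → G e ≟ᵇ true) {xs = allEdges} e∈)

  edgesWhere-++-isEdgeOrder : ∀ (G H : Graph n) → (∀ e → G e ≡ true → H e ≡ false) →
                              IsEdgeOrder (λ e → G e ∨ H e) (edgesWhere G ++ edgesWhere H)
  edgesWhere-++-isEdgeOrder G H disjoint =
    ++⁺ (edgesWhere-unique G) (edgesWhere-unique H) apart , λ e → listed⇒edge e , edge⇒listed e
    where
    apart : ∀ {e} → ¬ (e ∈ edgesWhere G × e ∈ edgesWhere H)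
    apart (e∈G , e∈H) with () ← trans (sym (disjoint _ (∈-edgesWhere⁻ G e∈G))) (∈-edgesWhere⁻ H e∈H)

    listed⇒edge : ∀ e → e ∈ edgesWhere G ++ edgesWhere H → G e ∨ H e ≡ true
    listed⇒edge e e∈ with ∈-++⁻ (edgesWhere G) e∈
    ... | inj₁ e∈G = cong (_∨ H e) (∈-edgesWhere⁻ G e∈G)
    ... | inj₂ e∈H = trans (cong (G e ∨_) (∈-edgesWhere⁻ H e∈H)) (∨-zeroʳ (G e))

    edge⇒listed : ∀ e → G e ∨ H e ≡ true → e ∈ edgesWhere G ++ edgesWhere H
    edge⇒listed e GHe with G e in Ge
    ... | true  = ∈-++⁺ˡ (∈-edgesWhere⁺ G Ge)
    ... | false = ∈-++⁺ʳ (edgesWhere G) (∈-edgesWhere⁺ H GHe)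

module _ {n m : ℕ} (V : Verifier n m) where
  open Verifier V

  stateAfter : Certificate → ℕ → List (Edge n) → Vec Bool m
  stateAfter cert k = foldl (step cert) (init cert k)

  run-++ : ∀ cert k xs ys → run V cert k (xs ++ ys) ≡ accept cert (foldl (step cert) (stateAfter cert k xs) ys)
  run-++ cert k xs ys = cong (accept cert) (foldl-++ (step cert) (init cert k) xs ys)

  run-++-cong : ∀ {cert cert′} k xs xs′ ys → cert ≡ cert′ → stateAfter cert k xs ≡ stateAfter cert′ k xs′ →
                run V cert k (xs ++ ys) ≡ run V cert′ k (xs′ ++ ys)
  run-++-cong {cert} k xs xs′ ys refl same = begin
    run V cert k (xs ++ ys)                                    ≡⟨ run-++ cert k xs ys ⟩
    accept cert (foldl (step cert) (stateAfter cert k xs) ys)  ≡⟨ cong (λ σ → accept cert (foldl (step cert) σ ys)) same ⟩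
    accept cert (foldl (step cert) (stateAfter cert k xs′) ys) ≡⟨ run-++ cert k xs′ ys ⟨
    run V cert k (xs′ ++ ys)                                   ∎
    where open ≡-Reasoning

injectiveOn⇒∣∣≤ : ∀ {n k} (S : Subset n) (T : Subset k) (f : Fin n → Fin k) →
                  (∀ {u} → u ∈ₛ S → f u ∈ₛ T) → (∀ {u v} → u ∈ₛ S → v ∈ₛ S → f u ≡ f v → u ≡ v) →
                  ∣ S ∣ ≤ ∣ T ∣
injectiveOn⇒∣∣≤ []ᵛ          T f _    _   = z≤n
injectiveOn⇒∣∣≤ (false ∷ᵛ S) T f into inj =
  injectiveOn⇒∣∣≤ S T (f ∘ suc) (into ∘ there) λ u∈ v∈ eq → suc-injective (inj (there u∈) (there v∈) eq)
injectiveOn⇒∣∣≤ (true ∷ᵛ S)  T f into inj =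
  ≤-trans (s≤s (injectiveOn⇒∣∣≤ S (T - f zero) (f ∘ suc) into′ inj′)) (x∈p⇒∣p-x∣<∣p∣ (into here))
  where
  inj′ : ∀ {u v} → u ∈ₛ S → v ∈ₛ S → f (suc u) ≡ f (suc v) → u ≡ v
  inj′ u∈ v∈ eq = suc-injective (inj (there u∈) (there v∈) eq)

  into′ : ∀ {u} → u ∈ₛ S → f (suc u) ∈ₛ T - f zero
  into′ u∈ = x∈p∧x≢y⇒x∈p-y (into (there u∈)) λ eq → contradiction (inj here (there u∈) (sym eq)) λ ()

image : ∀ {k n} → (Fin k → Fin n) → Subset n
image f = tabulate λ u → does (any? λ i → f i ≟ u)

∈-image⁺ : ∀ {k n} (f : Fin k → Fin n) i → f i ∈ₛ image f
∈-image⁺ f i = lookup⇒[]= (f i) (image f) (trans (lookup∘tabulate _ (f i)) (dec-true (any? _) (i , refl)))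

∈-image⁻ : ∀ {k n} (f : Fin k → Fin n) {u} → u ∈ₛ image f → ∃[ i ] f i ≡ u
∈-image⁻ f {u} u∈ with any? (λ i → f i ≟ u) | trans (sym (lookup∘tabulate _ u)) ([]=⇒lookup u∈)
... | yes found | _ = found
... | no  _     | ()

module _ {n : ℕ} where

  fromRelation : (Fin n → Fin n → Bool) → Graph n
  fromRelation R ((u , v) , _) = R u v

  independent⇒nonadjacent : ∀ R {S} → (∀ u v → R u v ≡ R v u) → Independent (fromRelation R) S →
                            ∀ {u v} → u ∈ₛ S → v ∈ₛ S → u ≢ v → R u v ≡ false
  independent⇒nonadjacent R R-sym indep {u} {v} u∈ v∈ u≢v with <-cmp u v
  ... | tri< u<v _   _   = ¬-not λ Ruv → indep u v u<v Ruv (u∈ , v∈)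
  ... | tri≈ _   u≡v _   = contradiction u≡v u≢v
  ... | tri> _   _   v<u = trans (R-sym u v) (¬-not λ Rvu → indep v u v<u Rvu (v∈ , u∈))

  nonadjacent⇒independent : ∀ R {S} → (∀ {u v} → u ∈ₛ S → v ∈ₛ S → u ≢ v → R u v ≡ false) →
                            Independent (fromRelation R) S
  nonadjacent⇒independent R nonadjacent u v u<v Ruv (u∈ , v∈)
    with () ← trans (sym Ruv) (nonadjacent u∈ v∈ (<⇒≢ u<v))

pattern A = zero
pattern B = suc zero
pattern C = suc (suc zero)
pattern D = suc (suc (suc zero))

Label : ℕ → Set
Label s = Fin 4 × Fin s

Matrix : ℕ → Set
Matrix s = Fin s → Fin s → Bool

differ : ∀ {s} → Fin s → Fin s → Bool
differ i j = not (does (i ≟ j))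

differ-refl : ∀ {s} (i : Fin s) → differ i i ≡ false
differ-refl i = cong not (dec-true (i ≟ i) refl)

differ≡false⇒≡ : ∀ {s} (i j : Fin s) → differ i j ≡ false → i ≡ j
differ≡false⇒≡ i j h with i ≟ j | h
... | yes i≡j | _ = i≡j
... | no  _   | ()

xPart : ∀ {s} → Matrix s → Label s → Label s → Bool
xPart M (A , _) (A , _) = true
xPart M (B , _) (B , _) = true
xPart M (A , i) (B , j) = M i j
xPart M (A , i) (C , j) = differ i j
xPart M (B , i) (D , j) = differ i j
xPart M _       _       = false

yPart : ∀ {s} → Matrix s → Label s → Label s → Bool
yPart M′ (C , _) (C , _) = true
yPart M′ (D , _) (D , _) = true
yPart M′ (C , i) (D , j) = not (M′ i j)
yPart M′ _       _       = false

symmetrise : ∀ {X : Set} → (X → X → Bool) → X → X → Bool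
symmetrise R x y = R x y ∨ R y x

adjacent : ∀ {s} → Matrix s → Matrix s → Label s → Label s → Bool
adjacent M M′ x y = symmetrise (xPart M) x y ∨ symmetrise (yPart M′) x y

adjacent-sym : ∀ {s} (M M′ : Matrix s) x y → adjacent M M′ x y ≡ adjacent M M′ y x
adjacent-sym M M′ x y = cong₂ _∨_ (∨-comm (xPart M x y) _) (∨-comm (yPart M′ x y) _)

sameBlock-adjacent : ∀ {s} (M M′ : Matrix s) (x y : Label s) → proj₁ x ≡ proj₁ y → adjacent M M′ x y ≡ true
sameBlock-adjacent M M′ (A , _) _ refl = refl
sameBlock-adjacent M M′ (B , _) _ refl = refl
sameBlock-adjacent M M′ (C , _) _ refl = refl
sameBlock-adjacent M M′ (D , _) _ refl = refl

symmetrise-xPart-yPart-disjoint : ∀ {s} (M M′ : Matrix s) x y →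
                                  symmetrise (xPart M) x y ≡ true → symmetrise (yPart M′) x y ≡ false
symmetrise-xPart-yPart-disjoint M M′ (A , _) (A , _) _  = refl
symmetrise-xPart-yPart-disjoint M M′ (A , _) (B , _) _  = refl
symmetrise-xPart-yPart-disjoint M M′ (A , _) (C , _) _  = refl
symmetrise-xPart-yPart-disjoint M M′ (A , _) (D , _) _  = refl
symmetrise-xPart-yPart-disjoint M M′ (B , _) (A , _) _  = refl
symmetrise-xPart-yPart-disjoint M M′ (B , _) (B , _) _  = refl
symmetrise-xPart-yPart-disjoint M M′ (B , _) (C , _) _  = refl
symmetrise-xPart-yPart-disjoint M M′ (B , _) (D , _) _  = refl
symmetrise-xPart-yPart-disjoint M M′ (C , _) (A , _) _  = refl
symmetrise-xPart-yPart-disjoint M M′ (C , _) (B , _) _  = refl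
symmetrise-xPart-yPart-disjoint M M′ (C , _) (C , _) ()
symmetrise-xPart-yPart-disjoint M M′ (C , _) (D , _) ()
symmetrise-xPart-yPart-disjoint M M′ (D , _) (A , _) _  = refl
symmetrise-xPart-yPart-disjoint M M′ (D , _) (B , _) _  = refl
symmetrise-xPart-yPart-disjoint M M′ (D , _) (C , _) ()
symmetrise-xPart-yPart-disjoint M M′ (D , _) (D , _) ()

¬independentTransversal : ∀ {s} (M : Matrix s) (a b c d : Label s) →
  proj₁ a ≡ A → proj₁ b ≡ B → proj₁ c ≡ C → proj₁ d ≡ D →
  adjacent M M a b ≡ false → adjacent M M a c ≡ false → adjacent M M b d ≡ false → adjacent M M c d ≡ false → ⊥
¬independentTransversal M (_ , i) (_ , j) (_ , k) (_ , l) refl refl refl refl ab ac bd cd =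
  contradiction (begin
    false   ≡⟨ Mij≡false ⟨
    M i j   ≡⟨ cong₂ M i≡k j≡l ⟩
    M k l   ≡⟨ Mkl≡true ⟩
    true    ∎) λ ()
  where
  open ≡-Reasoning
  i≡k : i ≡ k
  i≡k = differ≡false⇒≡ i k (∨-conicalˡ _ _ (∨-conicalˡ _ _ ac))

  j≡l : j ≡ l
  j≡l = differ≡false⇒≡ j l (∨-conicalˡ _ _ (∨-conicalˡ _ _ bd))

  Mij≡false : M i j ≡ false
  Mij≡false = ∨-conicalˡ _ _ (∨-conicalˡ _ _ ab)

  Mkl≡true : M k l ≡ true
  Mkl≡true = not-injective (∨-conicalˡ _ _ (∨-conicalʳ false _ cd))

coordinate : ∀ {s} → Fin s → Fin s → Fin 4 → Fin s
coordinate p q A = p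
coordinate p q B = q
coordinate p q C = p
coordinate p q D = q

transversal : ∀ {s} → Fin s → Fin s → Fin 4 → Label s
transversal p q b = b , coordinate p q b

transversal-nonadjacent : ∀ {s} {M M′ : Matrix s} {p q} → M p q ≡ false → M′ p q ≡ true →
  ∀ b b′ → b ≢ b′ → adjacent M M′ (transversal p q b) (transversal p q b′) ≡ false
transversal-nonadjacent _   _    A A A≢A = contradiction refl A≢A
transversal-nonadjacent _   _    B B B≢B = contradiction refl B≢B
transversal-nonadjacent _   _    C C C≢C = contradiction refl C≢C
transversal-nonadjacent _   _    D D D≢D = contradiction refl D≢D
transversal-nonadjacent Mpq _    A B _ rewrite Mpq = refl
transversal-nonadjacent Mpq _    B A _ rewrite Mpq = refl
transversal-nonadjacent {p = p} _ _ A C _ rewrite differ-refl p = refl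
transversal-nonadjacent {p = p} _ _ C A _ rewrite differ-refl p = refl
transversal-nonadjacent {q = q} _ _ B D _ rewrite differ-refl q = refl
transversal-nonadjacent {q = q} _ _ D B _ rewrite differ-refl q = refl
transversal-nonadjacent _   M′pq C D _ rewrite M′pq = refl
transversal-nonadjacent _   M′pq D C _ rewrite M′pq = refl
transversal-nonadjacent _   _    A D _ = refl
transversal-nonadjacent _   _    D A _ = refl
transversal-nonadjacent _   _    B C _ = refl
transversal-nonadjacent _   _    C B _ = refl

module Gadget {n s : ℕ} (label : Fin n → Label s) where

  block : Fin n → Fin 4
  block = proj₁ ∘ label

  adjacency : Matrix s → Matrix s → Fin n → Fin n → Bool
  adjacency M M′ u v = adjacent M M′ (label u) (label v)

  xEdges : Matrix s → Graph n
  xEdges M = fromRelation λ u v → symmetrise (xPart M) (label u) (label v)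

  yEdges : Matrix s → Graph n
  yEdges M′ = fromRelation λ u v → symmetrise (yPart M′) (label u) (label v)

  gadget : Matrix s → Matrix s → Graph n
  gadget M M′ e = xEdges M e ∨ yEdges M′ e

  gadgetStream : Matrix s → Matrix s → List (Edge n)
  gadgetStream M M′ = edgesWhere (xEdges M) ++ edgesWhere (yEdges M′)

  gadgetStream-isEdgeOrder : ∀ M M′ → IsEdgeOrder (gadget M M′) (gadgetStream M M′)
  gadgetStream-isEdgeOrder M M′ = edgesWhere-++-isEdgeOrder (xEdges M) (yEdges M′)
    λ ((u , v) , _) → symmetrise-xPart-yPart-disjoint M M′ (label u) (label v)

  module YesInstance (M : Matrix s) (S : Subset n) (indep : Independent (gadget M M) S) where

    nonadjacent : ∀ {u v} → u ∈ₛ S → v ∈ₛ S → u ≢ v → adjacency M M u v ≡ false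
    nonadjacent = independent⇒nonadjacent (adjacency M M) (λ u v → adjacent-sym M M (label u) (label v)) indep

    block-injectiveOn : ∀ {u v} → u ∈ₛ S → v ∈ₛ S → block u ≡ block v → u ≡ v
    block-injectiveOn {u} {v} u∈ v∈ same with u ≟ v
    ... | yes u≡v = u≡v
    ... | no  u≢v with () ← trans (sym (sameBlock-adjacent M M (label u) (label v) same)) (nonadjacent u∈ v∈ u≢v)

    Occupied : Fin 4 → Set
    Occupied b = ∃[ u ] u ∈ₛ S × block u ≡ b

    occupied? : ∀ b → Dec (Occupied b)
    occupied? b = any? λ u → (u ∈? S) ×-dec (block u ≟ b)

    ¬allOccupied : (∀ b → Occupied b) → ⊥
    ¬allOccupied occupied =
      ¬independentTransversal M (label (vertexIn A)) (label (vertexIn B)) (label (vertexIn C)) (label (vertexIn D))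
        (blockOf A) (blockOf B) (blockOf C) (blockOf D)
        (apart A B λ ()) (apart A C λ ()) (apart B D λ ()) (apart C D λ ())
      where
      vertexIn : Fin 4 → Fin n
      vertexIn b = proj₁ (occupied b)

      blockOf : ∀ b → block (vertexIn b) ≡ b
      blockOf b = proj₂ (proj₂ (occupied b))

      apart : ∀ b b′ → b ≢ b′ → adjacency M M (vertexIn b) (vertexIn b′) ≡ false
      apart b b′ b≢b′ = nonadjacent (proj₁ (proj₂ (occupied b))) (proj₁ (proj₂ (occupied b′)))
        λ eq → b≢b′ (trans (sym (blockOf b)) (trans (cong block eq) (blockOf b′)))

    ∣S∣≤3 : ∣ S ∣ ≤ 3
    ∣S∣≤3 with all? occupied?
    ... | yes occupied = ⊥-elim (¬allOccupied occupied)
    ... | no ¬occupied with b , b-free ← ¬∀⟶∃¬ 4 Occupied occupied? ¬occupied =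
      ≤-pred (≤-trans (s≤s (injectiveOn⇒∣∣≤ S (⊤ - b) block avoids-b block-injectiveOn))
                      (x∈p⇒∣p-x∣<∣p∣ (∈⊤ {x = b})))
      where
      avoids-b : ∀ {u} → u ∈ₛ S → block u ∈ₛ ⊤ - b
      avoids-b {u} u∈ = x∈p∧x≢y⇒x∈p-y ∈⊤ λ eq → b-free (u , u∈ , eq)

  gadget-MaxIS≤3 : ∀ M → MaxIS≤ (gadget M M) 3
  gadget-MaxIS≤3 M S indep = YesInstance.∣S∣≤3 M S indep

  gadget-¬MaxIS≤3 : (vertex : Label s → Fin n) → (∀ x → label (vertex x) ≡ x) →
                    ∀ {M M′ p q} → M p q ≡ false → M′ p q ≡ true → ¬ MaxIS≤ (gadget M M′) 3
  gadget-¬MaxIS≤3 vertex label∘vertex {M} {M′} {p} {q} Mpq M′pq maxIS≤3 =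
    <-irrefl refl (≤-trans 4≤∣S∣ (maxIS≤3 S independent))
    where
    w : Fin 4 → Fin n
    w = vertex ∘ transversal p q

    S : Subset n
    S = image w

    label∘w : ∀ b → label (w b) ≡ transversal p q b
    label∘w b = label∘vertex (transversal p q b)

    nonadjacent : ∀ {u v} → ∃[ b ] w b ≡ u → ∃[ b′ ] w b′ ≡ v → u ≢ v → adjacency M M′ u v ≡ false
    nonadjacent (b , refl) (b′ , refl) w≢w′ rewrite label∘w b | label∘w b′ =
      transversal-nonadjacent Mpq M′pq b b′ λ b≡b′ → w≢w′ (cong w b≡b′)

    independent : Independent (gadget M M′) S
    independent = nonadjacent⇒independent (adjacency M M′) λ u∈ v∈ → nonadjacent (∈-image⁻ w u∈) (∈-image⁻ w v∈)

    4≤∣S∣ : 4 ≤ ∣ S ∣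
    4≤∣S∣ = injectiveOn⇒∣∣≤ ⊤ S w (λ {b} _ → ∈-image⁺ w b)
      λ _ _ eq → ,-injectiveˡ (trans (sym (label∘w _)) (trans (cong label eq) (label∘w _)))

module LowerBound {n c m s : ℕ} (L : Fin n ↩ Label s) (scheme : HasScheme n c m) where
  open LeftInverse L using () renaming (to to label; from to vertex; strictlyInverseˡ to label∘vertex)
  open Gadget label

  V : Verifier n m
  V = proj₁ scheme

  matrix : Vec Bool (s * s) → Matrix s
  matrix w p q = lookup w (combine p q)

  certified : ∀ w → Σ[ cert ∈ Certificate ] (length cert ≤ c ×
    ((es : List (Edge n)) → IsEdgeOrder (gadget (matrix w) (matrix w)) es → run V cert 3 es ≡ true))
  certified w = proj₁ (proj₂ scheme) 3 (gadget (matrix w) (matrix w)) (gadget-MaxIS≤3 (matrix w))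

  certificate : Vec Bool (s * s) → Certificate
  certificate = proj₁ ∘ certified

  firstHalf : Vec Bool (s * s) → List (Edge n)
  firstHalf w = edgesWhere (xEdges (matrix w))

  memory : Vec Bool (s * s) → Vec Bool m
  memory w = stateAfter V (certificate w) 3 (firstHalf w)

  fooled : ∀ {w w′ p q} → certificate w ≡ certificate w′ → memory w ≡ memory w′ →
           matrix w p q ≡ false → matrix w′ p q ≡ true → ⊥
  fooled {w} {w′} same-certificate same-memory Mpq M′pq = contradiction (trans (sym rejects) accepts) λ ()
    where
    rejects : run V (certificate w) 3 (gadgetStream (matrix w) (matrix w′)) ≡ false
    rejects = proj₂ (proj₂ scheme) 3 (gadget (matrix w) (matrix w′)) (gadget-¬MaxIS≤3 vertex label∘vertex Mpq M′pq)
                (certificate w) _ (gadgetStream-isEdgeOrder _ _)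

    accepts : run V (certificate w) 3 (gadgetStream (matrix w) (matrix w′)) ≡ true
    accepts = begin
      run V (certificate w) 3 (gadgetStream (matrix w) (matrix w′))
        ≡⟨ run-++-cong V 3 (firstHalf w) (firstHalf w′) _ same-certificate same-memory ⟩
      run V (certificate w′) 3 (gadgetStream (matrix w′) (matrix w′))
        ≡⟨ proj₂ (proj₂ (certified w′)) _ (gadgetStream-isEdgeOrder _ _) ⟩
      true
        ∎
      where open ≡-Reasoning

  matrix-determined : ∀ {w w′} → certificate w ≡ certificate w′ → memory w ≡ memory w′ →
                      ∀ p q → matrix w p q ≡ matrix w′ p q
  matrix-determined {w} {w′} same-certificate same-memory p q with matrix w p q in Mpq | matrix w′ p q in M′pq
  ... | false | false = refl
  ... | true  | true  = refl
  ... | false | true  = ⊥-elim (fooled {w} {w′} same-certificate same-memory Mpq M′pq)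
  ... | true  | false = ⊥-elim (fooled {w′} {w} (sym same-certificate) (sym same-memory) M′pq Mpq)

  matrix-injective : ∀ {w w′} → (∀ p q → matrix w p q ≡ matrix w′ p q) → w ≡ w′
  matrix-injective {w} {w′} same = begin
    w                    ≡⟨ tabulate∘lookup w ⟨
    tabulate (lookup w)  ≡⟨ tabulate-cong entry ⟩
    tabulate (lookup w′) ≡⟨ tabulate∘lookup w′ ⟩
    w′                   ∎
    where
    open ≡-Reasoning
    entry : ∀ i → lookup w i ≡ lookup w′ i
    entry i = subst (λ j → lookup w j ≡ lookup w′ j) (combine-remQuot {s} s i) (uncurry same (remQuot {s} s i))

  message : Vec Bool (s * s) → Vec Bool (suc c + m)
  message w = pad c (certificate w) ++ᵛ memory w

  message-injective : ∀ {w w′} → message w ≡ message w′ → w ≡ w′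
  message-injective {w} {w′} eq
    with same-pad , same-memory ← ++-injective (pad c (certificate w)) (pad c (certificate w′)) eq =
    matrix-injective (matrix-determined {w} {w′} (pad-injective (length≤c w) (length≤c w′) same-pad) same-memory)
    where
    length≤c : ∀ w → length (certificate w) ≤ c
    length≤c w = proj₁ (proj₂ (certified w))

  s²≤1+c+m : s * s ≤ suc c + m
  s²≤1+c+m = Vec[Bool]↣⇒≤ (mk↣ message-injective)

-- Vertices beyond the first 4 s take the label of their residue modulo 4 s.
labelling : ∀ {n} s .{{_ : NonZero s}} → 4 * s ≤ n → Fin n ↩ Label s
labelling s 4s≤n = ↔⇒↩ (*↔× {4} {s}) ↩-∘ Fin[n]↩Fin[d] {{m*n≢0 4 s}} 4s≤n

n≤6[n/4] : ∀ n → 2 ≤ n / 4 → n ≤ 6 * (n / 4)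
n≤6[n/4] n 2≤s = begin
  n                         ≡⟨ m≡m%n+[m/n]*n n 4 ⟩
  n % 4 + n / 4 * 4         ≤⟨ +-monoˡ-≤ (n / 4 * 4) (<⇒≤ (≤-trans (m%n<n n 4) (*-monoʳ-≤ 2 2≤s))) ⟩
  2 * (n / 4) + n / 4 * 4   ≡⟨ solve 1 (λ s → con 2 :* s :+ s :* con 4 := con 6 :* s) refl (n / 4) ⟩
  6 * (n / 4)               ∎
  where open ≤-Reasoning

square-bound : ∀ n s t → 2 ≤ s → n ≤ 6 * s → s * s ≤ suc t → n * n ≤ 72 * t
square-bound n s t 2≤s n≤6s s²≤1+t = begin
  n * n              ≤⟨ *-mono-≤ n≤6s n≤6s ⟩
  6 * s * (6 * s)    ≡⟨ solve 1 (λ s → con 6 :* s :* (con 6 :* s) := con 36 :* (s :* s)) refl s ⟩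
  36 * (s * s)       ≤⟨ *-monoʳ-≤ 36 s²≤1+t ⟩
  36 * suc t         ≤⟨ *-monoʳ-≤ 36 (+-monoˡ-≤ t 1≤t) ⟩
  36 * (t + t)       ≡⟨ solve 1 (λ t → con 36 :* (t :+ t) := con 72 :* t) refl t ⟩
  72 * t             ∎
  where
  open ≤-Reasoning
  1≤t : 1 ≤ t
  1≤t = ≤-pred (≤-trans (s≤s (s≤s z≤n)) (≤-trans (*-mono-≤ 2≤s 2≤s) s²≤1+t))

corollary19 : ∃[ C ] ∃[ N ] ((n c m : ℕ) → N ≤ n → HasScheme n c m → n * n ≤ C * (c + m))
corollary19 = 72 , 8 , λ n c m 8≤n scheme →
  let 2≤s = /-monoˡ-≤ 4 8≤n
      4s≤n = subst (_≤ n) (*-comm (n / 4) 4) (m/n*n≤m n 4)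
      L = labelling (n / 4) {{>-nonZero (≤-trans (s≤s z≤n) 2≤s)}} 4s≤n
  in square-bound n (n / 4) (c + m) 2≤s (n≤6[n/4] n 2≤s) (LowerBound.s²≤1+c+m L scheme)
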